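{- For every integer $m\ge 5$, the flower snark $J_m$ satisfies $2m\le \gamma_{\mathrm{sdR}}(J_m)\le 2m+1$.
   Context: For $m\ge5$, the flower snark $J_m$ has vertex set $\{a_i,b_i,c_i,d_i: i\in\mathbb{Z}_m\}$ and edge set consisting of $\{a_ib_i,a_ic_i,a_id_i: i\in\mathbb{Z}_m\}$, $\{b_ib_{i+1}: i\in\mathbb{Z}_m\}$, and $\{c_0c_1,c_1c_2,\dots,c_{m-2}c_{m-1},\ c_{m-1}d_0,\ d_0d_1,\dots,d_{m-2}d_{m-1},\ c_0d_{m-1}\}$. $N(u)$ is the open neighborhood, $N[u]=N(u)\cup\{u\}$; for $f:V\to\{ -1,1,2,3\}$, $V_i=f^{ -1}(i)$, $f(S)=\sum_{s\in S}f(s)$. A signed double Roman domination function (SDRDF) is $f:V\to\{ -1,1,2,3\}$ with: (1) every $u\in V_{ -1}$ has a neighbor in $V_3$ or at least two distinct neighbors in $V_2$; (2) every $u\in V_1$ has a neighbor in $V_2\cup V_3$; (3) $f(N[u])\ge1$ for all $u$. $\gamma_{\mathrm{sdR}}(G)$ is the minimum of $f(V)$ over all SDRDFs on $G$. -}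

module Defs where

open import Data.Nat using (ℕ; zero; suc; _≡ᵇ_; _<ᵇ_; _∸_; NonZero)
open import Data.Nat.DivMod using (_%_)
open import Data.Fin using (Fin; toℕ)
open import Data.Fin.Properties using () renaming (_≟_ to _≟ᶠ_)
open import Data.Bool using (Bool; true; false; _∧_; _∨_; if_then_else_; T)
open import Data.Integer using (ℤ; +_; -[1+_]; _+_; _≤_)
open import Data.List using (List; allFin; filter; map; foldr)
open import Data.Product using (_×_; _,_; ∃; Σ; proj₁; proj₂)
open import Data.Sum using (_⊎_)
open import Relation.Binary.PropositionalEquality using (_≡_; _≢_)
open import Relation.Nullary using (Dec; yes; no)
open import Relation.Nullary.Decidable using (⌊_⌋)

record Graph : Set where
  field
    n   : ℕ
    adj : Fin n → Fin n → Bool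

open Graph public

Adj : (G : Graph) → Fin (n G) → Fin (n G) → Set
Adj G u v = T (adj G u v)

inClosed : (G : Graph) → Fin (n G) → Fin (n G) → Bool
inClosed G u v = ⌊ u ≟ᶠ v ⌋ ∨ adj G u v

sumℤ : List ℤ → ℤ
sumℤ = foldr _+_ (+ 0)

closedSum : (G : Graph) → (Fin (n G) → ℤ) → Fin (n G) → ℤ
closedSum G f u = sumℤ (map f (filter (λ v → T? (inClosed G u v)) (allFin (n G))))
  where
  open import Data.Bool.Properties using () renaming (T? to T?)

weight : (G : Graph) → (Fin (n G) → ℤ) → ℤ
weight G f = sumℤ (map f (allFin (n G)))

data Label : Set where
  m1 one two three : Label

val : Label → ℤ
val m1    = -[1+ 0 ]
val one   = + 1
val two   = + 2
val three = + 3

record IsSDRDF (G : Graph) (f : Fin (n G) → Label) : Set where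
  field
    cond-1 : ∀ u → f u ≡ m1 →
               (∃ λ v → Adj G u v × f v ≡ three)
             ⊎ (Σ (Fin (n G)) λ v → Σ (Fin (n G)) λ w →
                  v ≢ w × Adj G u v × Adj G u w × f v ≡ two × f w ≡ two)
    cond-2 : ∀ u → f u ≡ one →
               ∃ λ v → Adj G u v × (f v ≡ two ⊎ f v ≡ three)
    cond-3 : ∀ u → + 1 ≤ closedSum G (λ v → val (f v)) u

sdrWeight : (G : Graph) → (Fin (n G) → Label) → ℤ
sdrWeight G f = weight G (λ v → val (f v))

IsMinSDR : Graph → ℤ → Set
IsMinSDR G k = (Σ (Fin (n G) → Label) λ f → IsSDRDF G f × sdrWeight G f ≡ k)
             × (∀ f → IsSDRDF G f → k ≤ sdrWeight G f)

-- Flower snark J_m.  Vertex (t, i) with t ∈ {a,b,c,d} and i ∈ Z_m is encoded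
-- as the natural number 4*i + t, t = 0,1,2,3 for a,b,c,d.

-- adjacency on "kind, index" pairs (indices as naturals < m)
-- edges: a_i b_i, a_i c_i, a_i d_i, b_i b_{i+1 mod m},
--        c_i c_{i+1} (i ≤ m-2), d_i d_{i+1} (i ≤ m-2), c_{m-1} d_0, c_0 d_{m-1}
snarkEdge : (m : ℕ) → ℕ → ℕ → ℕ → ℕ → Bool
snarkEdge m 0 i 1 j = i ≡ᵇ j
snarkEdge m 0 i 2 j = i ≡ᵇ j
snarkEdge m 0 i 3 j = i ≡ᵇ j
snarkEdge m 1 i 1 j = (suc i ≡ᵇ j) ∨ ((suc i ≡ᵇ m) ∧ (j ≡ᵇ 0))
snarkEdge m 2 i 2 j = suc i ≡ᵇ j
snarkEdge m 3 i 3 j = suc i ≡ᵇ j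
snarkEdge m 2 i 3 j = ((suc i ≡ᵇ m) ∧ (j ≡ᵇ 0)) ∨ ((i ≡ᵇ 0) ∧ (suc j ≡ᵇ m))
snarkEdge m _ _ _ _ = false

snarkAdjℕ : (m : ℕ) → ℕ → ℕ → ℕ → ℕ → Bool
snarkAdjℕ m s i t j = snarkEdge m s i t j ∨ snarkEdge m t j s i

kind : ℕ → ℕ
kind x = x % 4

index : ℕ → ℕ
index x = Data.Nat._/_ x 4
  where import Data.Nat

flowerSnark : ℕ → Graph
flowerSnark m = record
  { n   = 4 Data.Nat.* m
  ; adj = λ u v → snarkAdjℕ m (kind (toℕ u)) (index (toℕ u)) (kind (toℕ v)) (index (toℕ v))
  }
  where import Data.Nat

{-# OPTIONS --safe #-}
module Submission where

-- Lower bound, by discharging.  Every vertex v starts with charge 6 f(v).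
-- Along the two rim cycles b_0 … b_{m-1} and c_0 … c_{m-1} d_0 … d_{m-1}
-- every rim vertex passes charge to its successor and to its hub a_i
-- (rimCharge, hubCharge).  Checking all labellings of a vertex and its
-- three neighbours shows that afterwards every column {a_i, b_i, c_i, d_i}
-- holds at least 12, while the charge passed along the rims cancels around
-- the cycles; hence 6 f(V) ≥ 12 m.
--
-- Upper bound.  The column labelling (a, b, c, d) ↦ (-1, 2, 2, 2) with one
-- rim vertex lowered to -1, the lowered vertex moving b → c → d → b from
-- column to column, is valid and has weight 2 per column.  Across the seam
-- between column m-1 and column 0 the rims c and d are exchanged, so the
-- pattern only closes up after inserting one column of weight 3, placed
-- according to m mod 3: weight 2m + 1.

open import Defs
open import Data.Bool using (Bool; true; false; not; _∧_; _∨_; T; if_then_else_)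
open import Data.Bool.ListAction using (any; all)
open import Data.Bool.Properties using (T?; T-∨; T-∧)
open import Data.Fin as Fin using (Fin; toℕ)
open import Data.Fin.Properties using (toℕ-fromℕ<; toℕ-injective; toℕ<n) renaming (_≟_ to _≟ᶠ_)
open import Data.Integer using (ℤ; +_; -[1+_]; _+_; _-_; -_; _*_; _≤_; _≤ᵇ_)
import Data.Integer.Properties as ℤ
open import Data.Integer.Tactic.RingSolver using (solve-∀)
open import Data.List using (List; []; _∷_; map; filter; allFin; tabulate)
open import Data.List.Properties using (map-∘; map-tabulate; map-cong-local)
open import Data.List.Membership.Propositional using (_∈_; find; lose)
open import Data.List.Membership.Propositional.Properties
  using (∈-filter⁺; ∈-filter⁻; ∈-allFin; ∈-map⁺; ∈-map⁻)
open import Data.List.Membership.Propositional.Properties.WithK using (unique∧set⇒bag)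
open import Data.List.Relation.Binary.BagAndSetEquality using (∼bag⇒↭)
open import Data.List.Relation.Binary.Permutation.Propositional using (_↭_; ↭⇒↭ₛ)
import Data.List.Relation.Binary.Permutation.Propositional.Properties as ↭
import Data.List.Relation.Binary.Permutation.Setoid.Properties as ↭ₛ
open import Data.List.Relation.Unary.All as All using (All; []; _∷_)
import Data.List.Relation.Unary.All.Properties as All
open import Data.List.Relation.Unary.Any using (here; there)
open import Data.List.Relation.Unary.Any.Properties using (any⁺; any⁻)
  renaming (map⁺ to Any-map⁺; map⁻ to Any-map⁻)
open import Data.List.Relation.Unary.Unique.Propositional using (Unique; []; _∷_)
  renaming (tail to Unique-tail)
open import Data.List.Relation.Unary.Unique.Propositional.Properties using (filter⁺; allFin⁺)
import Data.Nat
open import Data.Nat as ℕ using (ℕ; zero; suc; _<_; _≥_; _≡ᵇ_; z≤n; s≤s)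
import Data.Nat.Properties as ℕ
open import Data.Nat.DivMod
  using (_mod_; m%n<n; m<n⇒m%n≡m; [m+kn]%n≡m%n; +-distrib-/-∣ʳ; m*n/n≡m; m<n⇒m/n≡0; m<n*o⇒m/o<n; m≡m%n+[m/n]*n)
open import Data.Nat.Divisibility using (divides-refl)
import Data.Nat.Tactic.RingSolver as ℕ-Solver
open import Data.Product using (_×_; _,_; proj₁; proj₂; Σ; ∃; map₂)
open import Data.Sum using (_⊎_; inj₁; inj₂; [_,_]′) renaming (swap to ⊎-swap)
open import Function using (_⇔_; mk⇔; Equivalence; _∘_; id)
open import Relation.Binary.PropositionalEquality
  using (_≡_; _≢_; refl; sym; trans; cong; cong₂; subst; subst₂; setoid; module ≡-Reasoning)
open import Relation.Nullary.Decidable using (yes; no; ⌊_⌋; dec-true; dec-false)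
open import Relation.Nullary.Negation using (contradiction)

open Equivalence using (to; from)

isThree isTwo isTwoOrThree : Label → Bool
isThree three = true
isThree _     = false
isTwo two = true
isTwo _   = false
isTwoOrThree two   = true
isTwoOrThree three = true
isTwoOrThree _     = false

isThree-spec : ∀ {l} → T (isThree l) ⇔ l ≡ three
isThree-spec {m1}    = mk⇔ (λ ()) (λ ())
isThree-spec {one}   = mk⇔ (λ ()) (λ ())
isThree-spec {two}   = mk⇔ (λ ()) (λ ())
isThree-spec {three} = mk⇔ (λ _ → refl) (λ _ → _)

isTwo-spec : ∀ {l} → T (isTwo l) ⇔ l ≡ two
isTwo-spec {m1}    = mk⇔ (λ ()) (λ ())
isTwo-spec {one}   = mk⇔ (λ ()) (λ ())
isTwo-spec {two}   = mk⇔ (λ _ → refl) (λ _ → _)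
isTwo-spec {three} = mk⇔ (λ ()) (λ ())

isTwoOrThree-spec : ∀ {l} → T (isTwoOrThree l) ⇔ (l ≡ two ⊎ l ≡ three)
isTwoOrThree-spec {m1}    = mk⇔ (λ ()) λ { (inj₁ ()) ; (inj₂ ()) }
isTwoOrThree-spec {one}   = mk⇔ (λ ()) λ { (inj₁ ()) ; (inj₂ ()) }
isTwoOrThree-spec {two}   = mk⇔ (λ _ → inj₁ refl) (λ _ → _)
isTwoOrThree-spec {three} = mk⇔ (λ _ → inj₂ refl) (λ _ → _)

atLeastTwoᵇ : {A : Set} → (A → Bool) → List A → Bool
atLeastTwoᵇ p []       = false
atLeastTwoᵇ p (x ∷ xs) = (p x ∧ any p xs) ∨ atLeastTwoᵇ p xs

dominatedᵇ : Label → List Label → Bool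
dominatedᵇ m1  ls = any isThree ls ∨ atLeastTwoᵇ isTwo ls
dominatedᵇ one ls = any isTwoOrThree ls
dominatedᵇ _   _  = true

-- Conditions (1)–(3) at a vertex with neighbour labels ls, as a Boolean so
-- that they can be checked on all labellings by evaluation.
sdrAtᵇ : Label → List Label → Bool
sdrAtᵇ l ls = dominatedᵇ l ls ∧ (+ 1 ≤ᵇ sumℤ (map val (l ∷ ls)))

module _ {A B : Set} (p : B → Bool) (f : A → B) where

  any-map⇔ : ∀ xs → T (any p (map f xs)) ⇔ (∃ λ x → x ∈ xs × T (p (f x)))
  any-map⇔ xs = mk⇔ (find ∘ Any-map⁻ ∘ any⁻ p (map f xs))
                    (λ (_ , x∈xs , px) → any⁺ p (Any-map⁺ (lose x∈xs px)))

  TwoDistinct : List A → Set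
  TwoDistinct xs = ∃ λ x → ∃ λ y → x ≢ y × x ∈ xs × y ∈ xs × T (p (f x)) × T (p (f y))

  atLeastTwo-map⁻ : ∀ {xs} → Unique xs → T (atLeastTwoᵇ p (map f xs)) → TwoDistinct xs
  atLeastTwo-map⁻ {x ∷ xs} (x∉xs ∷ _) h with to T-∨ h
  ... | inj₁ px∧ with to T-∧ px∧
  ...   | px , any-p with to (any-map⇔ xs) any-p
  ...     | y , y∈xs , py = x , y , All.lookup x∉xs y∈xs , here refl , there y∈xs , px , py
  atLeastTwo-map⁻ {x ∷ xs} (_ ∷ !xs) h | inj₂ h′ with atLeastTwo-map⁻ !xs h′
  ... | y , z , y≢z , y∈ , z∈ , py , pz = y , z , y≢z , there y∈ , there z∈ , py , pz

  atLeastTwo-map⁺ : ∀ {xs} → TwoDistinct xs → T (atLeastTwoᵇ p (map f xs))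
  atLeastTwo-map⁺ (x , y , x≢y , here refl , here refl , _) = contradiction refl x≢y
  atLeastTwo-map⁺ (x , y , _ , here refl , there y∈ , px , py) =
    from T-∨ (inj₁ (from T-∧ (px , from (any-map⇔ _) (y , y∈ , py))))
  atLeastTwo-map⁺ (x , y , _ , there x∈ , here refl , px , py) =
    from T-∨ (inj₁ (from T-∧ (py , from (any-map⇔ _) (x , x∈ , px))))
  atLeastTwo-map⁺ {z ∷ _} (x , y , x≢y , there x∈ , there y∈ , px , py) =
    from (T-∨ {p (f z) ∧ _}) (inj₂ (atLeastTwo-map⁺ (x , y , x≢y , x∈ , y∈ , px , py)))

record Neighbourhood (G : Graph) (u : Fin (n G)) : Set where
  field
    nbrs     : List (Fin (n G))
    adj⇔∈    : ∀ {v} → Adj G u v ⇔ v ∈ nbrs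
    distinct : Unique (u ∷ nbrs)

module _ {G : Graph} {u : Fin (n G)} (N : Neighbourhood G u) where
  open Neighbourhood N

  inClosed⇔∈ : ∀ {v} → T (inClosed G u v) ⇔ v ∈ u ∷ nbrs
  inClosed⇔∈ {v} = mk⇔ ⇒ ⇐
    where
    ⇒ : T (inClosed G u v) → v ∈ u ∷ nbrs
    ⇒ uv with u ≟ᶠ v
    ... | yes refl = here refl
    ... | no _     = there (to adj⇔∈ uv)
    ⇐ : v ∈ u ∷ nbrs → T (inClosed G u v)
    ⇐ (here refl) with u ≟ᶠ u
    ... | yes _   = _
    ... | no u≢u  = contradiction refl u≢u
    ⇐ (there v∈nbrs) = from (T-∨ {⌊ u ≟ᶠ v ⌋}) (inj₂ (from adj⇔∈ v∈nbrs))

  closedNbhd↭ : filter (λ v → T? (inClosed G u v)) (allFin (n G)) ↭ u ∷ nbrs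
  closedNbhd↭ = ∼bag⇒↭ (unique∧set⇒bag (filter⁺ P? (allFin⁺ (n G))) distinct
    (mk⇔ (to inClosed⇔∈ ∘ proj₂ ∘ ∈-filter⁻ P? {xs = allFin (n G)})
         (∈-filter⁺ P? (∈-allFin _) ∘ from inClosed⇔∈)))
    where
    P? = λ v → T? (inClosed G u v)

  closedSum≡ : ∀ h → closedSum G h u ≡ sumℤ (map h (u ∷ nbrs))
  closedSum≡ h = ↭ₛ.foldr-commMonoid (setoid ℤ) ℤ.+-0-isCommutativeMonoid (↭⇒↭ₛ (↭.map⁺ h closedNbhd↭))

  module _ (f : Fin (n G) → Label) where

    private
      adjacent-any⇔ : ∀ p → T (any p (map f nbrs)) ⇔ (∃ λ v → Adj G u v × T (p (f v)))
      adjacent-any⇔ p = mk⇔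
        (map₂ (λ (v∈ , pv) → from adj⇔∈ v∈ , pv) ∘ to (any-map⇔ p f nbrs))
        (from (any-map⇔ p f nbrs) ∘ map₂ (λ (uv , pv) → to adj⇔∈ uv , pv))

      closedWeight≡ : closedSum G (val ∘ f) u ≡ sumℤ (map val (f u ∷ map f nbrs))
      closedWeight≡ = trans (closedSum≡ (val ∘ f)) (cong sumℤ (map-∘ {g = val} {f = f} (u ∷ nbrs)))

    IsSDRDF⇒sdrAtᵇ : IsSDRDF G f → T (sdrAtᵇ (f u) (map f nbrs))
    IsSDRDF⇒sdrAtᵇ S = from T-∧ (dominated , ℤ.≤⇒≤ᵇ (subst (+ 1 ≤_) closedWeight≡ (IsSDRDF.cond-3 S u)))
      where
      dominated : T (dominatedᵇ (f u) (map f nbrs))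
      dominated with f u in eq
      ... | m1 with IsSDRDF.cond-1 S u eq
      ...   | inj₁ (v , uv , fv≡3) =
        from T-∨ (inj₁ (from (adjacent-any⇔ isThree) (v , uv , from isThree-spec fv≡3)))
      ...   | inj₂ (v , w , v≢w , uv , uw , fv≡2 , fw≡2) =
        from (T-∨ {any isThree (map f nbrs)}) (inj₂ (atLeastTwo-map⁺ isTwo f
          (v , w , v≢w , to adj⇔∈ uv , to adj⇔∈ uw , from isTwo-spec fv≡2 , from isTwo-spec fw≡2)))
      dominated | one with IsSDRDF.cond-2 S u eq
      ...   | v , uv , fv≥2 = from (adjacent-any⇔ isTwoOrThree) (v , uv , from isTwoOrThree-spec fv≥2)
      dominated | two   = _
      dominated | three = _

    module _ (ok : T (sdrAtᵇ (f u) (map f nbrs))) where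

      private
        dominated : T (dominatedᵇ (f u) (map f nbrs))
        dominated = proj₁ (to T-∧ ok)

      sdrAtᵇ⇒cond-1 : f u ≡ m1 →
                        (∃ λ v → Adj G u v × f v ≡ three)
                      ⊎ (Σ (Fin (n G)) λ v → Σ (Fin (n G)) λ w →
                           v ≢ w × Adj G u v × Adj G u w × f v ≡ two × f w ≡ two)
      sdrAtᵇ⇒cond-1 fu≡m1 with to T-∨ (subst (λ l → T (dominatedᵇ l (map f nbrs))) fu≡m1 dominated)
      ... | inj₁ three-nbr with to (adjacent-any⇔ isThree) three-nbr
      ...   | v , uv , fv≡3 = inj₁ (v , uv , to isThree-spec fv≡3)
      sdrAtᵇ⇒cond-1 _ | inj₂ two-nbrs with atLeastTwo-map⁻ isTwo f (Unique-tail distinct) two-nbrs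
      ...   | v , w , v≢w , v∈ , w∈ , fv≡2 , fw≡2 =
        inj₂ (v , w , v≢w , from adj⇔∈ v∈ , from adj⇔∈ w∈ , to isTwo-spec fv≡2 , to isTwo-spec fw≡2)

      sdrAtᵇ⇒cond-2 : f u ≡ one → ∃ λ v → Adj G u v × (f v ≡ two ⊎ f v ≡ three)
      sdrAtᵇ⇒cond-2 fu≡1 with to (adjacent-any⇔ isTwoOrThree)
                                 (subst (λ l → T (dominatedᵇ l (map f nbrs))) fu≡1 dominated)
      ... | v , uv , fv≥2 = v , uv , to isTwoOrThree-spec fv≥2

      sdrAtᵇ⇒cond-3 : + 1 ≤ closedSum G (val ∘ f) u
      sdrAtᵇ⇒cond-3 = subst (+ 1 ≤_) (sym closedWeight≡) (ℤ.≤ᵇ⇒≤ (proj₂ (to T-∧ ok)))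

LocallySDR : (G : Graph) → (Fin (n G) → Label) → Fin (n G) → Set
LocallySDR G f u = Σ (Neighbourhood G u) λ N → T (sdrAtᵇ (f u) (map f (Neighbourhood.nbrs N)))

locallySDR⇒IsSDRDF : ∀ {G} f → (∀ u → LocallySDR G f u) → IsSDRDF G f
locallySDR⇒IsSDRDF f loc = record
  { cond-1 = λ u → sdrAtᵇ⇒cond-1 (proj₁ (loc u)) f (proj₂ (loc u))
  ; cond-2 = λ u → sdrAtᵇ⇒cond-2 (proj₁ (loc u)) f (proj₂ (loc u))
  ; cond-3 = λ u → sdrAtᵇ⇒cond-3 (proj₁ (loc u)) f (proj₂ (loc u))
  }

-- Discharging on a single column

labels : List Label
labels = m1 ∷ one ∷ two ∷ three ∷ []

∈-labels : ∀ l → l ∈ labels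
∈-labels m1    = here refl
∈-labels one   = there (here refl)
∈-labels two   = there (there (here refl))
∈-labels three = there (there (there (here refl)))

∀ᵇ : (Label → Bool) → Bool
∀ᵇ p = all p labels

∀ᵇ-sound : ∀ p → T (∀ᵇ p) → ∀ l → T (p l)
∀ᵇ-sound p h l = All.lookup (All.all⁺ p labels h) (∈-labels l)

∀ᵇ⁴ : (Label → Label → Label → Label → Bool) → Bool
∀ᵇ⁴ P = ∀ᵇ λ x → ∀ᵇ λ y → ∀ᵇ λ z → ∀ᵇ λ w → P x y z w

∀ᵇ⁴-sound : ∀ P → T (∀ᵇ⁴ P) → ∀ x y z w → T (P x y z w)
∀ᵇ⁴-sound P h x y z w =
  ∀ᵇ-sound (P x y z) (∀ᵇ-sound (λ z → ∀ᵇ (P x y z))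
    (∀ᵇ-sound (λ y → ∀ᵇ λ z → ∀ᵇ (P x y z)) (∀ᵇ-sound (λ x → ∀ᵇ λ y → ∀ᵇ λ z → ∀ᵇ (P x y z)) h x) y) z) w

_⇒ᵇ_ : Bool → Bool → Bool
x ⇒ᵇ y = not x ∨ y

⇒ᵇ-elim : ∀ {x y} → T (x ⇒ᵇ y) → T x → T y
⇒ᵇ-elim {true} h _ = h

-- Charges are scaled by 6.  A rim vertex labelled x, whose predecessor on
-- its rim cycle is labelled p and whose hub is labelled h, receives
-- rimCharge p x from the predecessor and sends hubCharge h x to the hub.
rimCharge : Label → Label → ℤ
rimCharge m1    m1    = + 8
rimCharge m1    one   = + 6
rimCharge m1    two   = + 3
rimCharge m1    three = + 0
rimCharge one   m1    = + 10
rimCharge one   one   = + 6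
rimCharge one   _     = + 8
rimCharge two   m1    = + 13
rimCharge two   _     = + 8
rimCharge three m1    = + 16
rimCharge three _     = + 8

hubCharge : Label → Label → ℤ
hubCharge m1    m1    = + 4
hubCharge m1    one   = + 4
hubCharge m1    two   = + 7
hubCharge m1    three = + 10
hubCharge one   m1    = + 2
hubCharge one   one   = + 4
hubCharge one   _     = + 2
hubCharge two   m1    = -[1+ 0 ]
hubCharge two   _     = + 2
hubCharge three m1    = -[1+ 3 ]
hubCharge three _     = + 2

rimDischargeᵇ : Label → Label → Label → Label → Bool
rimDischargeᵇ x h p s =
  sdrAtᵇ x (h ∷ p ∷ s ∷ []) ⇒ᵇ (hubCharge h x + rimCharge x s ≤ᵇ + 6 * val x + rimCharge p x)

rim-discharge : ∀ x h p s → T (sdrAtᵇ x (h ∷ p ∷ s ∷ [])) →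
                hubCharge h x + rimCharge x s ≤ + 6 * val x + rimCharge p x
rim-discharge x h p s ok = ℤ.≤ᵇ⇒≤ (⇒ᵇ-elim (∀ᵇ⁴-sound rimDischargeᵇ _ x h p s) ok)

hubDischargeᵇ : Label → Label → Label → Label → Bool
hubDischargeᵇ h x y z =
  sdrAtᵇ h (x ∷ y ∷ z ∷ []) ⇒ᵇ (+ 12 ≤ᵇ + 6 * val h + (hubCharge h x + (hubCharge h y + hubCharge h z)))

hub-discharge : ∀ h x y z → T (sdrAtᵇ h (x ∷ y ∷ z ∷ [])) →
                + 12 ≤ + 6 * val h + (hubCharge h x + (hubCharge h y + hubCharge h z))
hub-discharge h x y z ok = ℤ.≤ᵇ⇒≤ (⇒ᵇ-elim (∀ᵇ⁴-sound hubDischargeᵇ _ h x y z) ok)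

data Kind : Set where
  a b c d : Kind

swap : Kind → Kind
swap c = d
swap d = c
swap t = t

hubOKᵇ : (Kind → Label) → Bool
hubOKᵇ x = sdrAtᵇ (x a) (x b ∷ x c ∷ x d ∷ [])

rimOKᵇ : (Kind → Label) → (Kind → Label) → (Kind → Label) → Kind → Bool
rimOKᵇ p x s t = sdrAtᵇ (x t) (x a ∷ p t ∷ s t ∷ [])

columnOKᵇ : (Kind → Label) → (Kind → Label) → (Kind → Label) → Bool
columnOKᵇ p x s = hubOKᵇ x ∧ (rimOKᵇ p x s b ∧ (rimOKᵇ p x s c ∧ rimOKᵇ p x s d))

ColumnOK : (Kind → Label) → (Kind → Label) → (Kind → Label) → Set
ColumnOK p x s = T (hubOKᵇ x) × T (rimOKᵇ p x s b) × T (rimOKᵇ p x s c) × T (rimOKᵇ p x s d)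

columnOK⇔ : ∀ p x s → T (columnOKᵇ p x s) ⇔ ColumnOK p x s
columnOK⇔ p x s = mk⇔
  (λ ok → let h , r = to (T-∧ {hubOKᵇ x}) ok ; rb , r′ = to (T-∧ {rim b}) r ; rc , rd = to (T-∧ {rim c}) r′
          in h , rb , rc , rd)
  (λ (h , rb , rc , rd) → from T-∧ (h , from T-∧ (rb , from T-∧ (rc , rd))))
  where
  rim = rimOKᵇ p x s

columnWeight : (Kind → Label) → ℤ
columnWeight x = val (x a) + (val (x b) + (val (x c) + val (x d)))

flow : (Kind → Label) → (Kind → Label) → ℤ
flow p x = rimCharge (p b) (x b) + (rimCharge (p c) (x c) + rimCharge (p d) (x d))

flow-swap : ∀ p x → flow (p ∘ swap) x ≡ flow p (x ∘ swap)
flow-swap p x = cong (_+_ (rimCharge (p b) (x b))) (ℤ.+-comm (rimCharge (p d) (x c)) (rimCharge (p c) (x d)))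

private
  cancel-discharged : ∀ z h₁ h₂ h₃ o₁ o₂ o₃ →
    (z + ((h₁ + o₁) + ((h₂ + o₂) + (h₃ + o₃)))) - ((h₁ + (h₂ + h₃)) + (o₁ + (o₂ + o₃))) ≡ z
  cancel-discharged = solve-∀

  cancel-received : ∀ r v₀ v₁ v₂ v₃ h₁ h₂ h₃ o₁ o₂ o₃ i₁ i₂ i₃ →
    ((r * v₀ + (h₁ + (h₂ + h₃))) + ((r * v₁ + i₁) + ((r * v₂ + i₂) + (r * v₃ + i₃))))
      - ((h₁ + (h₂ + h₃)) + (o₁ + (o₂ + o₃)))
    ≡ r * (v₀ + (v₁ + (v₂ + v₃))) + ((i₁ + (i₂ + i₃)) - (o₁ + (o₂ + o₃)))
  cancel-received = solve-∀

column-discharge : ∀ p x s → T (columnOKᵇ p x s) → + 12 ≤ + 6 * columnWeight x + (flow p x - flow x s)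
column-discharge p x s ok with to (columnOK⇔ p x s) ok
... | hub-ok , b-ok , c-ok , d-ok = begin
  + 12                                                            ≡⟨ cancel-discharged (+ 12) (h b) (h c) (h d) (o b) (o c) (o d) ⟨
  (+ 12 + ((h b + o b) + ((h c + o c) + (h d + o d)))) - (H + O)  ≤⟨ ℤ.+-monoˡ-≤ (- (H + O)) (ℤ.+-mono-≤ hub
                                                                       (ℤ.+-mono-≤ (rim b b-ok) (ℤ.+-mono-≤ (rim c c-ok) (rim d d-ok)))) ⟩
  ((+ 6 * v a + H) + ((+ 6 * v b + i b) + ((+ 6 * v c + i c) + (+ 6 * v d + i d)))) - (H + O)
                                                                  ≡⟨ cancel-received (+ 6) (v a) (v b) (v c) (v d)
                                                                       (h b) (h c) (h d) (o b) (o c) (o d) (i b) (i c) (i d) ⟩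
  + 6 * columnWeight x + (flow p x - flow x s)                    ∎
  where
  open ℤ.≤-Reasoning
  v h o i : Kind → ℤ
  v t = val (x t)
  h t = hubCharge (x a) (x t)
  o t = rimCharge (x t) (s t)
  i t = rimCharge (p t) (x t)
  H O : ℤ
  H = h b + (h c + h d)
  O = o b + (o c + o d)
  hub : + 12 ≤ + 6 * v a + H
  hub = hub-discharge (x a) (x b) (x c) (x d) hub-ok
  rim : ∀ t → T (rimOKᵇ p x s t) → h t + o t ≤ + 6 * v t + i t
  rim t = rim-discharge (x t) (x a) (p t) (s t)

sumUpTo : ℕ → (ℕ → ℤ) → ℤ
sumUpTo zero    g = + 0
sumUpTo (suc n) g = g 0 + sumUpTo n (g ∘ suc)

sumUpTo-cong : ∀ n {g h : ℕ → ℤ} → (∀ i → i < n → g i ≡ h i) → sumUpTo n g ≡ sumUpTo n h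
sumUpTo-cong zero    _   = refl
sumUpTo-cong (suc n) g≡h = cong₂ _+_ (g≡h 0 (s≤s z≤n)) (sumUpTo-cong n (λ i i<n → g≡h (suc i) (s≤s i<n)))

sumUpTo-mono-≤ : ∀ n {g h : ℕ → ℤ} → (∀ i → i < n → g i ≤ h i) → sumUpTo n g ≤ sumUpTo n h
sumUpTo-mono-≤ zero    _   = ℤ.≤-refl
sumUpTo-mono-≤ (suc n) g≤h = ℤ.+-mono-≤ (g≤h 0 (s≤s z≤n)) (sumUpTo-mono-≤ n (λ i i<n → g≤h (suc i) (s≤s i<n)))

sumUpTo-+ : ∀ n (g h : ℕ → ℤ) → sumUpTo n (λ i → g i + h i) ≡ sumUpTo n g + sumUpTo n h
sumUpTo-+ zero    g h = refl
sumUpTo-+ (suc n) g h = trans (cong (_+_ (g 0 + h 0)) (sumUpTo-+ n (g ∘ suc) (h ∘ suc)))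
  (interchange (g 0) (h 0) (sumUpTo n (g ∘ suc)) (sumUpTo n (h ∘ suc)))
  where open import Algebra.Properties.CommutativeSemigroup ℤ.+-commutativeSemigroup using (interchange)

sumUpTo-neg : ∀ n (g : ℕ → ℤ) → sumUpTo n (λ i → - g i) ≡ - sumUpTo n g
sumUpTo-neg zero    g = refl
sumUpTo-neg (suc n) g =
  trans (cong (_+_ (- g 0)) (sumUpTo-neg n (g ∘ suc))) (sym (ℤ.neg-distrib-+ (g 0) (sumUpTo n (g ∘ suc))))

sumUpTo-- : ∀ n (g h : ℕ → ℤ) → sumUpTo n (λ i → g i - h i) ≡ sumUpTo n g - sumUpTo n h
sumUpTo-- n g h = trans (sumUpTo-+ n g (λ i → - h i)) (cong (_+_ (sumUpTo n g)) (sumUpTo-neg n h))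

sumUpTo-*ˡ : ∀ n r (g : ℕ → ℤ) → sumUpTo n (λ i → r * g i) ≡ r * sumUpTo n g
sumUpTo-*ˡ zero    r g = sym (ℤ.*-zeroʳ r)
sumUpTo-*ˡ (suc n) r g =
  trans (cong (_+_ (r * g 0)) (sumUpTo-*ˡ n r (g ∘ suc))) (sym (ℤ.*-distribˡ-+ r (g 0) (sumUpTo n (g ∘ suc))))

sumUpTo-const : ∀ n x → sumUpTo n (λ _ → + x) ≡ + (n ℕ.* x)
sumUpTo-const zero    x = refl
sumUpTo-const (suc n) x = trans (cong (_+_ (+ x)) (sumUpTo-const n x)) (sym (ℤ.pos-+ x (n ℕ.* x)))

sumUpTo-last : ∀ n (g : ℕ → ℤ) → sumUpTo (suc n) g ≡ sumUpTo n g + g n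
sumUpTo-last zero    g = ℤ.+-comm (g 0) (+ 0)
sumUpTo-last (suc n) g =
  trans (cong (_+_ (g 0)) (sumUpTo-last n (g ∘ suc))) (sym (ℤ.+-assoc (g 0) (sumUpTo n (g ∘ suc)) (g (suc n))))

sumUpTo-rotate : ∀ k {g h : ℕ → ℤ} → g 0 ≡ h k → (∀ i → i < k → g (suc i) ≡ h i) →
                 sumUpTo (suc k) g ≡ sumUpTo (suc k) h
sumUpTo-rotate k {g} {h} g0≡hk shift = begin
  g 0 + sumUpTo k (g ∘ suc)  ≡⟨ cong₂ _+_ g0≡hk (sumUpTo-cong k shift) ⟩
  h k + sumUpTo k h          ≡⟨ ℤ.+-comm (h k) (sumUpTo k h) ⟩
  sumUpTo k h + h k          ≡⟨ sumUpTo-last k h ⟨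
  sumUpTo (suc k) h          ∎
  where open ≡-Reasoning

sumUpTo-blocks : ∀ n (g : ℕ → ℤ) →
  sumUpTo (4 ℕ.* n) g ≡ sumUpTo n (λ i → g (i ℕ.* 4) + (g (1 ℕ.+ i ℕ.* 4) + (g (2 ℕ.+ i ℕ.* 4) + g (3 ℕ.+ i ℕ.* 4))))
sumUpTo-blocks zero    g = refl
sumUpTo-blocks (suc n) g = begin
  sumUpTo (4 ℕ.* suc n) g                                          ≡⟨ cong (λ N → sumUpTo N g) (ℕ.*-suc 4 n) ⟩
  g 0 + (g 1 + (g 2 + (g 3 + sumUpTo (4 ℕ.* n) (g ∘ (4 ℕ.+_)))))   ≡⟨ cong (λ S → g 0 + (g 1 + (g 2 + (g 3 + S))))
                                                                         (sumUpTo-blocks n (g ∘ (4 ℕ.+_))) ⟩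
  g 0 + (g 1 + (g 2 + (g 3 + S)))                                 ≡⟨ reassociate (g 0) (g 1) (g 2) (g 3) S ⟩
  (g 0 + (g 1 + (g 2 + g 3))) + S                                 ∎
  where
  open ≡-Reasoning
  S = sumUpTo n (λ i → g (4 ℕ.+ i ℕ.* 4) + (g (5 ℕ.+ i ℕ.* 4) + (g (6 ℕ.+ i ℕ.* 4) + g (7 ℕ.+ i ℕ.* 4))))
  reassociate : ∀ w x y z s → w + (x + (y + (z + s))) ≡ (w + (x + (y + z))) + s
  reassociate = solve-∀

sumℤ-tabulate : ∀ {n} {h : Fin n → ℤ} {g : ℕ → ℤ} → (∀ v → h v ≡ g (toℕ v)) → sumℤ (tabulate h) ≡ sumUpTo n g
sumℤ-tabulate {zero}  _   = refl
sumℤ-tabulate {suc n} h≡g = cong₂ _+_ (h≡g Fin.zero) (sumℤ-tabulate (h≡g ∘ Fin.suc))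

private
  ≡ᵇ-refl : ∀ x → (x ≡ᵇ x) ≡ true
  ≡ᵇ-refl x = dec-true (x ℕ.≟ x) refl

module Columns (k : ℕ) where

  m : ℕ
  m = suc k

  -- Column i is (a_i, b_i, c_i, d_i).  The rim edges from column m-1 to
  -- column 0 are b_{m-1}b_0, c_{m-1}d_0 and d_{m-1}c_0: crossing this seam
  -- exchanges c and d.
  before : {X : Set} → (ℕ → Kind → X) → ℕ → Kind → X
  before L zero    t = L k (swap t)
  before L (suc i) t = L i t

  after : {X : Set} → (ℕ → Kind → X) → ℕ → Kind → X
  after L i = if suc i ≡ᵇ m then L 0 ∘ swap else L (suc i)

  last-or-step : ∀ {i} → i < m → i ≡ k ⊎ suc i < m
  last-or-step (s≤s i≤k) with ℕ.m≤n⇒m<n∨m≡n i≤k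
  ... | inj₁ i<k  = inj₂ (s≤s i<k)
  ... | inj₂ refl = inj₁ refl

  after-last : ∀ {X} (L : ℕ → Kind → X) {i} → i ≡ k → after L i ≡ L 0 ∘ swap
  after-last L refl = cong (λ β → if β then L 0 ∘ swap else L m) (≡ᵇ-refl k)

  after-step : ∀ {X} (L : ℕ → Kind → X) {i} → suc i < m → after L i ≡ L (suc i)
  after-step L {i} si<m =
    cong (λ β → if β then L 0 ∘ swap else L (suc i)) (dec-false (suc i ℕ.≟ m) (ℕ.<⇒≢ si<m))

  ValidColumns : (ℕ → Kind → Label) → Set
  ValidColumns L = ∀ i → i < m → T (columnOKᵇ (before L i) (L i) (after L i))

  totalWeight : (ℕ → Kind → Label) → ℤ
  totalWeight L = sumUpTo m (columnWeight ∘ L)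

  netFlow : (ℕ → Kind → Label) → ℕ → ℤ
  netFlow L i = flow (before L i) (L i) - flow (L i) (after L i)

  sum-netFlow : ∀ L → sumUpTo m (netFlow L) ≡ + 0
  sum-netFlow L = begin
    sumUpTo m (λ i → inflow i - outflow i)  ≡⟨ sumUpTo-- m inflow outflow ⟩
    sumUpTo m inflow - sumUpTo m outflow    ≡⟨ cong (_- sumUpTo m outflow) (sumUpTo-rotate k {inflow} {outflow} seam shift) ⟩
    sumUpTo m outflow - sumUpTo m outflow   ≡⟨ ℤ.+-inverseʳ (sumUpTo m outflow) ⟩
    + 0                                     ∎
    where
    open ≡-Reasoning
    inflow outflow : ℕ → ℤ
    inflow i  = flow (before L i) (L i)
    outflow i = flow (L i) (after L i)
    seam : inflow 0 ≡ outflow k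
    seam = trans (flow-swap (L k) (L 0)) (cong (flow (L k)) (sym (after-last L refl)))
    shift : ∀ i → i < k → inflow (suc i) ≡ outflow i
    shift i i<k = cong (flow (L i)) (sym (after-step L (s≤s i<k)))

  ValidColumns⇒2m≤totalWeight : ∀ L → ValidColumns L → + (2 ℕ.* m) ≤ totalWeight L
  ValidColumns⇒2m≤totalWeight L valid = ℤ.*-cancelˡ-≤-pos (+ (2 ℕ.* m)) (totalWeight L) (+ 6) (begin
    + 6 * + (2 ℕ.* m)                                             ≡⟨ ℤ.pos-* 6 (2 ℕ.* m) ⟨
    + (6 ℕ.* (2 ℕ.* m))                                           ≡⟨ cong +_ (6*2m≡m*12 m) ⟩
    + (m ℕ.* 12)                                                  ≡⟨ sumUpTo-const m 12 ⟨
    sumUpTo m (λ _ → + 12)                                        ≤⟨ sumUpTo-mono-≤ m (λ i i<m →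
                                                                       column-discharge (before L i) (L i) (after L i) (valid i i<m)) ⟩
    sumUpTo m (λ i → + 6 * columnWeight (L i) + netFlow L i)      ≡⟨ sumUpTo-+ m (λ i → + 6 * columnWeight (L i)) (netFlow L) ⟩
    sumUpTo m (λ i → + 6 * columnWeight (L i)) + sumUpTo m (netFlow L)
                                                                  ≡⟨ cong₂ _+_ (sumUpTo-*ˡ m (+ 6) (columnWeight ∘ L)) (sum-netFlow L) ⟩
    + 6 * totalWeight L + + 0                                     ≡⟨ ℤ.+-identityʳ _ ⟩
    + 6 * totalWeight L                                           ∎)
    where
    open ℤ.≤-Reasoning
    6*2m≡m*12 : ∀ m → 6 ℕ.* (2 ℕ.* m) ≡ m ℕ.* 12
    6*2m≡m*12 = ℕ-Solver.solve-∀

code : Kind → ℕ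
code a = 0
code b = 1
code c = 2
code d = 3

code<4 : ∀ t → code t < 4
code<4 a = s≤s z≤n
code<4 b = s≤s (s≤s z≤n)
code<4 c = s≤s (s≤s (s≤s z≤n))
code<4 d = s≤s (s≤s (s≤s (s≤s z≤n)))

code-injective : ∀ s t → code s ≡ code t → s ≡ t
code-injective a a _ = refl
code-injective b b _ = refl
code-injective c c _ = refl
code-injective d d _ = refl
code-injective a b () ; code-injective a c () ; code-injective a d ()
code-injective b a () ; code-injective b c () ; code-injective b d ()
code-injective c a () ; code-injective c b () ; code-injective c d ()
code-injective d a () ; code-injective d b () ; code-injective d c ()

kindOf : ℕ → Kind
kindOf 0 = a
kindOf 1 = b
kindOf 2 = c
kindOf _ = d

code-kindOf : ∀ {x} → x < 4 → code (kindOf x) ≡ x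
code-kindOf {0} _ = refl
code-kindOf {1} _ = refl
code-kindOf {2} _ = refl
code-kindOf {3} _ = refl
code-kindOf {suc (suc (suc (suc _)))} (s≤s (s≤s (s≤s (s≤s ()))))

data IsRim : Kind → Set where
  rim-b : IsRim b
  rim-c : IsRim c
  rim-d : IsRim d

swap-rim : ∀ {t} → IsRim t → IsRim (swap t)
swap-rim rim-b = rim-b
swap-rim rim-c = rim-d
swap-rim rim-d = rim-c

Pos : Set
Pos = Kind × ℕ

position : ℕ → Kind → Pos
position i t = t , i

atPos : {X : Set} → (ℕ → Kind → X) → Pos → X
atPos L p = L (proj₂ p) (proj₁ p)

module FlowerSnark (k : ℕ) (2≤k : 2 ℕ.≤ k) where
  open Columns k

  G : Graph
  G = flowerSnark m

  InRange : Pos → Set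
  InRange p = proj₂ p < m

  -- Reduced mod 4m only to make vertex total; it is injective on InRange.
  vertex : Pos → Fin (n G)
  vertex (t , i) = (code t ℕ.+ i ℕ.* 4) mod (4 ℕ.* m)

  toℕ-vertex : ∀ t {i} → i < m → toℕ (vertex (t , i)) ≡ code t ℕ.+ i ℕ.* 4
  toℕ-vertex t {i} i<m = trans (toℕ-fromℕ< _) (m<n⇒m%n≡m (ℕ.<-≤-trans (ℕ.+-monoˡ-< (i ℕ.* 4) (code<4 t))
    (subst (suc i ℕ.* 4 ℕ.≤_) (ℕ.*-comm m 4) (ℕ.*-monoˡ-≤ 4 i<m))))

  kind-vertex : ∀ t {i} → i < m → kind (toℕ (vertex (t , i))) ≡ code t
  kind-vertex t {i} i<m =
    trans (cong kind (toℕ-vertex t i<m)) (trans ([m+kn]%n≡m%n (code t) i 4) (m<n⇒m%n≡m (code<4 t)))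

  index-vertex : ∀ t {i} → i < m → index (toℕ (vertex (t , i))) ≡ i
  index-vertex t {i} i<m = trans (cong index (toℕ-vertex t i<m))
    (trans (+-distrib-/-∣ʳ (code t) (divides-refl i)) (cong₂ ℕ._+_ (m<n⇒m/n≡0 (code<4 t)) (m*n/n≡m i 4)))

  vertex-injective : ∀ {p q} → InRange p → InRange q → vertex p ≡ vertex q → p ≡ q
  vertex-injective {s , i} {t , j} i<m j<m eq = cong₂ _,_
    (code-injective s t (trans (sym (kind-vertex s i<m)) (trans (cong (kind ∘ toℕ) eq) (kind-vertex t j<m))))
    (trans (sym (index-vertex s i<m)) (trans (cong (index ∘ toℕ) eq) (index-vertex t j<m)))

  positionOf : Fin (n G) → Pos
  positionOf u = kindOf (kind (toℕ u)) , index (toℕ u)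

  positionOf-inRange : ∀ u → InRange (positionOf u)
  positionOf-inRange u = m<n*o⇒m/o<n (subst (toℕ u <_) (ℕ.*-comm 4 m) (toℕ<n u))

  vertex-positionOf : ∀ u → vertex (positionOf u) ≡ u
  vertex-positionOf u = toℕ-injective (begin
    toℕ (vertex (positionOf u))                         ≡⟨ toℕ-vertex (kindOf (kind (toℕ u))) (positionOf-inRange u) ⟩
    code (kindOf (kind (toℕ u))) ℕ.+ index (toℕ u) ℕ.* 4  ≡⟨ cong (ℕ._+ index (toℕ u) ℕ.* 4) (code-kindOf (m%n<n (toℕ u) 4)) ⟩
    kind (toℕ u) ℕ.+ index (toℕ u) ℕ.* 4                  ≡⟨ m≡m%n+[m/n]*n (toℕ u) 4 ⟨
    toℕ u                                                ∎)
    where open ≡-Reasoning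

  positionOf-vertex : ∀ {p} → InRange p → positionOf (vertex p) ≡ p
  positionOf-vertex {p} p∈ = vertex-injective (positionOf-inRange (vertex p)) p∈ (vertex-positionOf (vertex p))

  SnarkAdj : Pos → Pos → Set
  SnarkAdj (s , i) (t , j) = T (snarkAdjℕ m (code s) i (code t) j)

  Adj-vertex : ∀ {p q} → InRange p → InRange q → Adj G (vertex p) (vertex q) ≡ SnarkAdj p q
  Adj-vertex {s , i} {t , j} i<m j<m = cong T (begin
    snarkAdjℕ m (kind (toℕ (vertex (s , i)))) (index (toℕ (vertex (s , i))))
                (kind (toℕ (vertex (t , j)))) (index (toℕ (vertex (t , j))))
      ≡⟨ cong₂ (λ x y → snarkAdjℕ m x (index (toℕ (vertex (s , i)))) y (index (toℕ (vertex (t , j)))))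
               (kind-vertex s i<m) (kind-vertex t j<m) ⟩
    snarkAdjℕ m (code s) (index (toℕ (vertex (s , i)))) (code t) (index (toℕ (vertex (t , j))))
      ≡⟨ cong₂ (λ x y → snarkAdjℕ m (code s) x (code t) y) (index-vertex s i<m) (index-vertex t j<m) ⟩
    snarkAdjℕ m (code s) i (code t) j
      ∎)
    where open ≡-Reasoning

  SnarkAdj-sym : ∀ {p q} → SnarkAdj p q → SnarkAdj q p
  SnarkAdj-sym {s , i} {t , j} = from T-∨ ∘ ⊎-swap ∘ to (T-∨ {snarkEdge m (code s) i (code t) j})

  data Arc : Pos → Pos → Set where
    spoke : ∀ {t i} → IsRim t → i < m → Arc (a , i) (t , i)
    step  : ∀ {t i} → IsRim t → suc i < m → Arc (t , i) (t , suc i)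
    wrap  : ∀ {t} → IsRim t → Arc (t , k) (swap t , 0)

  arc-inRange : ∀ {p q} → Arc p q → InRange p × InRange q
  arc-inRange (spoke _ i<m) = i<m , i<m
  arc-inRange (step _ si<m) = ℕ.<-trans (ℕ.n<1+n _) si<m , si<m
  arc-inRange (wrap _)      = ℕ.n<1+n k , s≤s z≤n

  arc⇒adjacent : ∀ {p q} → Arc p q → SnarkAdj p q
  arc⇒adjacent (spoke {b} {i} _ _) rewrite ≡ᵇ-refl i = _
  arc⇒adjacent (spoke {c} {i} _ _) rewrite ≡ᵇ-refl i = _
  arc⇒adjacent (spoke {d} {i} _ _) rewrite ≡ᵇ-refl i = _
  arc⇒adjacent (step {b} {i} _ _)  rewrite ≡ᵇ-refl i = _
  arc⇒adjacent (step {c} {i} _ _)  rewrite ≡ᵇ-refl i = _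
  arc⇒adjacent (step {d} {i} _ _)  rewrite ≡ᵇ-refl i = _
  arc⇒adjacent (wrap rim-b)        rewrite ≡ᵇ-refl k = _
  arc⇒adjacent (wrap rim-c)        rewrite ≡ᵇ-refl k = _
  arc⇒adjacent (wrap rim-d)        rewrite ≡ᵇ-refl k = from (T-∨ {(1 ≡ᵇ m) ∧ (k ≡ᵇ 0)}) (inj₂ _)

  private
    ≡ᵇ-sound : ∀ {x y} → T (x ≡ᵇ y) → x ≡ y
    ≡ᵇ-sound = ℕ.≡ᵇ⇒≡ _ _

    last-sound : ∀ {i} → T (suc i ≡ᵇ m) → i ≡ k
    last-sound = ℕ.suc-injective ∘ ≡ᵇ-sound

  edge⇒arc : ∀ s i t j → i < m → j < m → T (snarkEdge m (code s) i (code t) j) →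
             Arc (s , i) (t , j) ⊎ Arc (t , j) (s , i)
  edge⇒arc a i b j i<m _ e with refl ← ≡ᵇ-sound {i} {j} e = inj₁ (spoke rim-b i<m)
  edge⇒arc a i c j i<m _ e with refl ← ≡ᵇ-sound {i} {j} e = inj₁ (spoke rim-c i<m)
  edge⇒arc a i d j i<m _ e with refl ← ≡ᵇ-sound {i} {j} e = inj₁ (spoke rim-d i<m)
  edge⇒arc b i b j _ j<m e with to T-∨ e
  ... | inj₁ e′ with refl ← ≡ᵇ-sound {suc i} {j} e′ = inj₁ (step rim-b j<m)
  ... | inj₂ e′ with to T-∧ e′
  ...   | last , j≡0 with refl ← last-sound {i} last | refl ← ≡ᵇ-sound {j} {0} j≡0 = inj₁ (wrap rim-b)
  edge⇒arc c i c j _ j<m e with refl ← ≡ᵇ-sound {suc i} {j} e = inj₁ (step rim-c j<m)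
  edge⇒arc d i d j _ j<m e with refl ← ≡ᵇ-sound {suc i} {j} e = inj₁ (step rim-d j<m)
  edge⇒arc c i d j _ _ e with to T-∨ e
  ... | inj₁ e′ with to T-∧ e′
  ...   | last , j≡0 with refl ← last-sound {i} last | refl ← ≡ᵇ-sound {j} {0} j≡0 = inj₁ (wrap rim-c)
  edge⇒arc c i d j _ _ e | inj₂ e′ with to T-∧ e′
  ...   | i≡0 , last with refl ← ≡ᵇ-sound {i} {0} i≡0 | refl ← last-sound {j} last = inj₂ (wrap rim-d)
  edge⇒arc a _ a _ _ _ ()
  edge⇒arc b _ a _ _ _ ()
  edge⇒arc c _ a _ _ _ ()
  edge⇒arc d _ a _ _ _ ()
  edge⇒arc b _ c _ _ _ ()
  edge⇒arc b _ d _ _ _ ()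
  edge⇒arc c _ b _ _ _ ()
  edge⇒arc d _ b _ _ _ ()
  edge⇒arc d _ c _ _ _ ()

  adjacent⇒arc : ∀ {s i t j} → i < m → j < m → SnarkAdj (s , i) (t , j) →
                 Arc (s , i) (t , j) ⊎ Arc (t , j) (s , i)
  adjacent⇒arc {s} {i} {t} {j} i<m j<m e with to (T-∨ {snarkEdge m (code s) i (code t) j}) e
  ... | inj₁ st = edge⇒arc s i t j i<m j<m st
  ... | inj₂ ts = ⊎-swap (edge⇒arc t j s i j<m i<m ts)

  nbrPos : Pos → List Pos
  nbrPos (a , i) = (b , i) ∷ (c , i) ∷ (d , i) ∷ []
  nbrPos (t , i) = (a , i) ∷ before position i t ∷ after position i t ∷ []

  private
    rim-nbrPos : ∀ {t} i → IsRim t → nbrPos (t , i) ≡ (a , i) ∷ before position i t ∷ after position i t ∷ []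
    rim-nbrPos _ rim-b = refl
    rim-nbrPos _ rim-c = refl
    rim-nbrPos _ rim-d = refl

    after-position-last : ∀ {t i} → i ≡ k → after position i t ≡ (swap t , 0)
    after-position-last {t} i≡k = cong (λ L → L t) (after-last position i≡k)

    after-position-step : ∀ {t i} → suc i < m → after position i t ≡ (t , suc i)
    after-position-step {t} si<m = cong (λ L → L t) (after-step position si<m)

  arc⇒∈nbrPos : ∀ {p q} → Arc p q → q ∈ nbrPos p
  arc⇒∈nbrPos (spoke rim-b _) = here refl
  arc⇒∈nbrPos (spoke rim-c _) = there (here refl)
  arc⇒∈nbrPos (spoke rim-d _) = there (there (here refl))
  arc⇒∈nbrPos (step {i = i} r si<m) =
    subst (_ ∈_) (sym (rim-nbrPos i r)) (there (there (here (sym (after-position-step si<m)))))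
  arc⇒∈nbrPos (wrap r) =
    subst (_ ∈_) (sym (rim-nbrPos k r)) (there (there (here (sym (after-position-last refl)))))

  arc⇒∈nbrPos′ : ∀ {p q} → Arc q p → q ∈ nbrPos p
  arc⇒∈nbrPos′ (spoke rim-b _) = here refl
  arc⇒∈nbrPos′ (spoke rim-c _) = here refl
  arc⇒∈nbrPos′ (spoke rim-d _) = here refl
  arc⇒∈nbrPos′ (step rim-b _)  = there (here refl)
  arc⇒∈nbrPos′ (step rim-c _)  = there (here refl)
  arc⇒∈nbrPos′ (step rim-d _)  = there (here refl)
  arc⇒∈nbrPos′ (wrap rim-b)    = there (here refl)
  arc⇒∈nbrPos′ (wrap rim-c)    = there (here refl)
  arc⇒∈nbrPos′ (wrap rim-d)    = there (here refl)

  private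
    arc-before : ∀ {t} i → IsRim t → i < m → Arc (before position i t) (t , i)
    arc-before zero    rim-b _    = wrap rim-b
    arc-before zero    rim-c _    = wrap rim-d
    arc-before zero    rim-d _    = wrap rim-c
    arc-before (suc i) r     si<m = step r si<m

    arc-after : ∀ {t} i → IsRim t → i < m → Arc (t , i) (after position i t)
    arc-after {t} i r i<m with last-or-step i<m
    ... | inj₁ refl = subst (Arc (t , k)) (sym (after-position-last refl)) (wrap r)
    ... | inj₂ si<m = subst (Arc (t , i)) (sym (after-position-step si<m)) (step r si<m)

    rim-∈nbrPos⇒arc : ∀ {t i q} → IsRim t → i < m →
                       q ∈ (a , i) ∷ before position i t ∷ after position i t ∷ [] → Arc (t , i) q ⊎ Arc q (t , i)
    rim-∈nbrPos⇒arc r i<m (here refl)                 = inj₂ (spoke r i<m)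
    rim-∈nbrPos⇒arc r i<m (there (here refl))         = inj₂ (arc-before _ r i<m)
    rim-∈nbrPos⇒arc r i<m (there (there (here refl))) = inj₁ (arc-after _ r i<m)

  ∈nbrPos⇒arc : ∀ {p q} → InRange p → q ∈ nbrPos p → Arc p q ⊎ Arc q p
  ∈nbrPos⇒arc {a , i} i<m (here refl)                 = inj₁ (spoke rim-b i<m)
  ∈nbrPos⇒arc {a , i} i<m (there (here refl))         = inj₁ (spoke rim-c i<m)
  ∈nbrPos⇒arc {a , i} i<m (there (there (here refl))) = inj₁ (spoke rim-d i<m)
  ∈nbrPos⇒arc {b , i} = rim-∈nbrPos⇒arc rim-b
  ∈nbrPos⇒arc {c , i} = rim-∈nbrPos⇒arc rim-c
  ∈nbrPos⇒arc {d , i} = rim-∈nbrPos⇒arc rim-d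

  nbrPos-inRange : ∀ {p} → InRange p → All InRange (nbrPos p)
  nbrPos-inRange p∈ = All.tabulate λ q∈ → [ proj₂ ∘ arc-inRange , proj₁ ∘ arc-inRange ]′ (∈nbrPos⇒arc p∈ q∈)

  private
    index-≢ : ∀ {s t : Kind} {i j : ℕ} → i ≢ j → (s , i) ≢ (t , j)
    index-≢ i≢j = i≢j ∘ cong proj₂

    hub≢rim : ∀ {i} {q : Pos} → IsRim (proj₁ q) → (a , i) ≢ q
    hub≢rim () refl

    k≢0 : k ≢ 0
    k≢0 k≡0 with subst (2 ℕ.≤_) k≡0 2≤k
    ... | ()

    k≢1 : k ≢ 1
    k≢1 k≡1 with subst (2 ℕ.≤_) k≡1 2≤k
    ... | s≤s ()

    rim-before : ∀ {t} i → IsRim t → IsRim (proj₁ (before position i t))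
    rim-before zero    r = swap-rim r
    rim-before (suc i) r = r

    rim-after : ∀ {t} i → IsRim t → IsRim (proj₁ (after position i t))
    rim-after i r with suc i ≡ᵇ m
    ... | true  = swap-rim r
    ... | false = r

    self≢before : ∀ {t} i → (t , i) ≢ before position i t
    self≢before zero    = index-≢ (k≢0 ∘ sym)
    self≢before (suc i) = index-≢ (λ ())

    self≢after : ∀ {t i} → i < m → (t , i) ≢ after position i t
    self≢after {t} {i} i<m with last-or-step i<m
    ... | inj₁ refl = subst ((t , k) ≢_) (sym (after-position-last refl)) (index-≢ k≢0)
    ... | inj₂ si<m = subst ((t , i) ≢_) (sym (after-position-step si<m)) (index-≢ (λ ()))

    before≢after : ∀ {t} i → i < m → before position i t ≢ after position i t
    before≢after {t} zero i<m with last-or-step i<m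
    ... | inj₁ 0≡k = contradiction (sym 0≡k) k≢0
    ... | inj₂ 1<m = subst (before position 0 t ≢_) (sym (after-position-step 1<m)) (index-≢ k≢1)
    before≢after {t} (suc i) i<m with last-or-step i<m
    ... | inj₁ si≡k = subst ((t , i) ≢_) (sym (after-position-last si≡k))
                        (index-≢ λ i≡0 → k≢1 (trans (sym si≡k) (cong suc i≡0)))
    ... | inj₂ si<m = subst ((t , i) ≢_) (sym (after-position-step si<m)) (index-≢ (λ ()))

    rim-unique : ∀ {t i} → IsRim t → i < m →
                 Unique ((t , i) ∷ (a , i) ∷ before position i t ∷ after position i t ∷ [])
    rim-unique {t} {i} r i<m =
        (hub≢rim r ∘ sym ∷ self≢before i ∷ self≢after i<m ∷ [])
      ∷ (hub≢rim (rim-before i r) ∷ hub≢rim (rim-after i r) ∷ [])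
      ∷ (before≢after i i<m ∷ [])
      ∷ []
      ∷ []

  nbrPos-unique : ∀ {p} → InRange p → Unique (p ∷ nbrPos p)
  nbrPos-unique {a , i} _ = ((λ ()) ∷ (λ ()) ∷ (λ ()) ∷ []) ∷ ((λ ()) ∷ (λ ()) ∷ []) ∷ ((λ ()) ∷ []) ∷ [] ∷ []
  nbrPos-unique {b , i} = rim-unique rim-b
  nbrPos-unique {c , i} = rim-unique rim-c
  nbrPos-unique {d , i} = rim-unique rim-d

  vertex-unique : ∀ {ps} → All InRange ps → Unique ps → Unique (map vertex ps)
  vertex-unique []         []           = []
  vertex-unique (p∈ ∷ ps∈) (p∉ps ∷ !ps) =
    All.map⁺ (All.zipWith (λ (q∈ , p≢q) → p≢q ∘ vertex-injective p∈ q∈) (ps∈ , p∉ps)) ∷ vertex-unique ps∈ !ps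

  neighbourhood : ∀ {p} → InRange p → Neighbourhood G (vertex p)
  neighbourhood {p} p∈ = record
    { nbrs     = map vertex (nbrPos p)
    ; adj⇔∈    = mk⇔ ⇒ ⇐
    ; distinct = vertex-unique (p∈ ∷ nbrPos-inRange p∈) (nbrPos-unique p∈)
    }
    where
    ⇒ : ∀ {v} → Adj G (vertex p) v → v ∈ map vertex (nbrPos p)
    ⇒ {v} pv = subst (_∈ map vertex (nbrPos p)) (vertex-positionOf v) (∈-map⁺ vertex
      ([ arc⇒∈nbrPos , arc⇒∈nbrPos′ ]′ (adjacent⇒arc p∈ q∈
        (subst id (Adj-vertex {p} {positionOf v} p∈ q∈) (subst (Adj G (vertex p)) (sym (vertex-positionOf v)) pv)))))
      where
      q∈ = positionOf-inRange v
    ⇐ : ∀ {v} → v ∈ map vertex (nbrPos p) → Adj G (vertex p) v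
    ⇐ v∈ with ∈-map⁻ vertex v∈
    ... | q , q∈ , refl = subst id (sym (Adj-vertex {p} {q} p∈ (All.lookup (nbrPos-inRange p∈) q∈)))
      ([ arc⇒adjacent , SnarkAdj-sym {q} {p} ∘ arc⇒adjacent ]′ (∈nbrPos⇒arc p∈ q∈))

  columnsOf : (Fin (n G) → Label) → ℕ → Kind → Label
  columnsOf f i t = f (vertex (t , i))

  labelling : (ℕ → Kind → Label) → Fin (n G) → Label
  labelling L = atPos L ∘ positionOf

  labelling-vertex : ∀ L {p} → InRange p → labelling L (vertex p) ≡ atPos L p
  labelling-vertex L p∈ = cong (atPos L) (positionOf-vertex p∈)

  private
    atPos-before : ∀ {X} (L : ℕ → Kind → X) i t → atPos L (before position i t) ≡ before L i t
    atPos-before L zero    t = refl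
    atPos-before L (suc i) t = refl

    atPos-after : ∀ {X} (L : ℕ → Kind → X) i t → atPos L (after position i t) ≡ after L i t
    atPos-after L i t with suc i ≡ᵇ m
    ... | true  = refl
    ... | false = refl

    rim-labels : ∀ {X} (L : ℕ → Kind → X) {t} i → IsRim t →
                 map (atPos L) (nbrPos (t , i)) ≡ L i a ∷ before L i t ∷ after L i t ∷ []
    rim-labels L i rim-b = cong₂ (λ x y → L i a ∷ x ∷ y ∷ []) (atPos-before L i b) (atPos-after L i b)
    rim-labels L i rim-c = cong₂ (λ x y → L i a ∷ x ∷ y ∷ []) (atPos-before L i c) (atPos-after L i c)
    rim-labels L i rim-d = cong₂ (λ x y → L i a ∷ x ∷ y ∷ []) (atPos-before L i d) (atPos-after L i d)

  LocallyValid : (ℕ → Kind → Label) → Set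
  LocallyValid L = ∀ p → InRange p → T (sdrAtᵇ (atPos L p) (map (atPos L) (nbrPos p)))

  locallyValid⇒ValidColumns : ∀ L → LocallyValid L → ValidColumns L
  locallyValid⇒ValidColumns L loc i i<m =
    from (columnOK⇔ (before L i) (L i) (after L i)) (loc (a , i) i<m , rim rim-b , rim rim-c , rim rim-d)
    where
    rim : ∀ {t} → IsRim t → T (rimOKᵇ (before L i) (L i) (after L i) t)
    rim {t} r = subst (T ∘ sdrAtᵇ (L i t)) (rim-labels L i r) (loc (t , i) i<m)

  ValidColumns⇒locallyValid : ∀ L → ValidColumns L → LocallyValid L
  ValidColumns⇒locallyValid L valid (t , i) i<m with to (columnOK⇔ (before L i) (L i) (after L i)) (valid i i<m) | t
  ... | hub-ok , _ , _ , _ | a = hub-ok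
  ... | _ , b-ok , _ , _   | b = subst (T ∘ sdrAtᵇ (L i b)) (sym (rim-labels L i rim-b)) b-ok
  ... | _ , _ , c-ok , _   | c = subst (T ∘ sdrAtᵇ (L i c)) (sym (rim-labels L i rim-c)) c-ok
  ... | _ , _ , _ , d-ok   | d = subst (T ∘ sdrAtᵇ (L i d)) (sym (rim-labels L i rim-d)) d-ok

  IsSDRDF⇒ValidColumns : ∀ {f} → IsSDRDF G f → ValidColumns (columnsOf f)
  IsSDRDF⇒ValidColumns {f} S = locallyValid⇒ValidColumns (columnsOf f) λ p p∈ →
    subst (T ∘ sdrAtᵇ (f (vertex p))) (sym (map-∘ (nbrPos p))) (IsSDRDF⇒sdrAtᵇ (neighbourhood p∈) f S)

  ValidColumns⇒IsSDRDF : ∀ L → ValidColumns L → IsSDRDF G (labelling L)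
  ValidColumns⇒IsSDRDF L valid = locallySDR⇒IsSDRDF (labelling L) λ u →
    subst (LocallySDR G (labelling L)) (vertex-positionOf u)
          (neighbourhood {positionOf u} (positionOf-inRange u) , local {positionOf u} (positionOf-inRange u))
    where
    local : ∀ {p} → InRange p → T (sdrAtᵇ (labelling L (vertex p)) (map (labelling L) (map vertex (nbrPos p))))
    local {p} p∈ = subst₂ (λ l ls → T (sdrAtᵇ l ls)) (sym (labelling-vertex L p∈))
      (sym (trans (sym (map-∘ (nbrPos p))) (map-cong-local (All.map (λ {q} → labelling-vertex L {q}) (nbrPos-inRange p∈)))))
      (ValidColumns⇒locallyValid L valid p p∈)

  weight≡sumUpTo : ∀ (h : Fin (n G) → ℤ) →
    weight G h ≡ sumUpTo m (λ i → h (vertex (a , i)) + (h (vertex (b , i)) + (h (vertex (c , i)) + h (vertex (d , i)))))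
  weight≡sumUpTo h = begin
    sumℤ (map h (allFin (4 ℕ.* m)))                ≡⟨ cong sumℤ (map-tabulate id h) ⟩
    sumℤ (tabulate h)                              ≡⟨ sumℤ-tabulate {g = h ∘ (_mod (4 ℕ.* m))} (cong h ∘ sym ∘ toℕ-mod) ⟩
    sumUpTo (4 ℕ.* m) (h ∘ (_mod (4 ℕ.* m)))       ≡⟨ sumUpTo-blocks m (h ∘ (_mod (4 ℕ.* m))) ⟩
    _                                              ∎
    where
    open ≡-Reasoning
    toℕ-mod : ∀ v → toℕ v mod (4 ℕ.* m) ≡ v
    toℕ-mod v = toℕ-injective (trans (toℕ-fromℕ< _) (m<n⇒m%n≡m (toℕ<n v)))

  sdrWeight≡totalWeight : ∀ f → sdrWeight G f ≡ totalWeight (columnsOf f)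
  sdrWeight≡totalWeight f = weight≡sumUpTo (val ∘ f)

  totalWeight-labelling : ∀ L → totalWeight (columnsOf (labelling L)) ≡ totalWeight L
  totalWeight-labelling L = sumUpTo-cong m λ i i<m →
    let at t = cong val (labelling-vertex L {t , i} i<m) in cong₂ _+_ (at a) (cong₂ _+_ (at b) (cong₂ _+_ (at c) (at d)))

-- A labelling of weight 2m + 1

data Phase : Set where
  φ₀ φ₁ φ₂ : Phase

rotate : Phase → Phase
rotate φ₀ = φ₁
rotate φ₁ = φ₂
rotate φ₂ = φ₀

phase : ℕ → Phase
phase zero    = φ₀
phase (suc i) = rotate (phase i)

bulk : Phase → Kind → Label
bulk _  a = m1
bulk φ₀ b = m1
bulk φ₁ c = m1
bulk φ₂ d = m1
bulk _  _ = two

special : Phase → Kind → Label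
special _  a = one
special φ₀ b = m1
special φ₀ c = two
special φ₁ c = m1
special φ₁ d = two
special φ₂ d = m1
special φ₂ b = two
special _  _ = one

gadget : Phase → ℕ → Kind → Label
gadget φ₀ 0 = special φ₀
gadget φ₀ 1 = bulk φ₁
gadget φ₀ _ = bulk φ₂
gadget φ₁ 0 = bulk φ₂
gadget φ₁ 1 = special φ₁
gadget φ₁ _ = bulk φ₂
gadget φ₂ 0 = bulk φ₁
gadget φ₂ 1 = bulk φ₀
gadget φ₂ _ = special φ₂

bulk-valid : ∀ φ → T (columnOKᵇ (bulk φ) (bulk (rotate φ)) (bulk (rotate (rotate φ))))
bulk-valid φ₀ = _
bulk-valid φ₁ = _
bulk-valid φ₂ = _

module Construction (j : ℕ) where
  open Columns (4 ℕ.+ j)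

  L₀ : ℕ → Kind → Label
  L₀ (suc (suc (suc i))) = bulk (phase i)
  L₀ i                   = gadget (phase m) i

  L₀-valid : ValidColumns L₀
  L₀-valid 0 _ with phase j
  ... | φ₀ = _
  ... | φ₁ = _
  ... | φ₂ = _
  L₀-valid 1 _ with phase j
  ... | φ₀ = _
  ... | φ₁ = _
  ... | φ₂ = _
  L₀-valid 2 _ with phase j
  ... | φ₀ = _
  ... | φ₁ = _
  ... | φ₂ = _
  L₀-valid 3 _ with phase j
  ... | φ₀ = _
  ... | φ₁ = _
  ... | φ₂ = _
  L₀-valid (suc (suc (suc (suc i)))) i<m with last-or-step i<m
  ... | inj₂ si<m = subst (T ∘ columnOKᵇ (bulk (phase i)) (bulk (phase (suc i))))
                          (sym (after-step L₀ si<m)) (bulk-valid (phase i))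
  ... | inj₁ refl = subst (T ∘ columnOKᵇ (bulk (phase j)) (bulk (phase (suc j))))
                          (sym (after-last L₀ refl)) seam
    where
    seam : T (columnOKᵇ (bulk (phase j)) (bulk (phase (suc j))) (gadget (phase m) 0 ∘ swap))
    seam with phase j
    ... | φ₀ = _
    ... | φ₁ = _
    ... | φ₂ = _

  L₀-weight : totalWeight L₀ ≡ + (2 ℕ.* m ℕ.+ 1)
  L₀-weight = begin
    w 0 + (w 1 + (w 2 + sumUpTo (2 ℕ.+ j) (w ∘ (3 ℕ.+_))))  ≡⟨ reassociate (w 0) (w 1) (w 2) _ ⟩
    (w 0 + (w 1 + w 2)) + sumUpTo (2 ℕ.+ j) (w ∘ (3 ℕ.+_))   ≡⟨ cong₂ _+_ gadget-weight bulk-weight ⟩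
    + 7 + + ((2 ℕ.+ j) ℕ.* 2)                               ≡⟨ ℤ.pos-+ 7 ((2 ℕ.+ j) ℕ.* 2) ⟨
    + (7 ℕ.+ (2 ℕ.+ j) ℕ.* 2)                               ≡⟨ cong +_ (7+2[2+j]≡2[5+j]+1 j) ⟩
    + (2 ℕ.* m ℕ.+ 1)                                       ∎
    where
    open ≡-Reasoning
    w : ℕ → ℤ
    w = columnWeight ∘ L₀
    reassociate : ∀ x y z s → x + (y + (z + s)) ≡ (x + (y + z)) + s
    reassociate = solve-∀
    gadget-weight : w 0 + (w 1 + w 2) ≡ + 7
    gadget-weight with phase j
    ... | φ₀ = refl
    ... | φ₁ = refl
    ... | φ₂ = refl
    bulk-columnWeight : ∀ φ → columnWeight (bulk φ) ≡ + 2
    bulk-columnWeight φ₀ = refl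
    bulk-columnWeight φ₁ = refl
    bulk-columnWeight φ₂ = refl
    bulk-weight : sumUpTo (2 ℕ.+ j) (w ∘ (3 ℕ.+_)) ≡ + ((2 ℕ.+ j) ℕ.* 2)
    bulk-weight = trans (sumUpTo-cong (2 ℕ.+ j) λ i _ → bulk-columnWeight (phase i)) (sumUpTo-const (2 ℕ.+ j) 2)
    7+2[2+j]≡2[5+j]+1 : ∀ j → 7 ℕ.+ (2 ℕ.+ j) ℕ.* 2 ≡ 2 ℕ.* (5 ℕ.+ j) ℕ.+ 1
    7+2[2+j]≡2[5+j]+1 = ℕ-Solver.solve-∀

proposition2 : ∀ (m : ℕ) → m ≥ 5 → ∀ (γ : ℤ) → IsMinSDR (flowerSnark m) γ →
    (+ (2 Data.Nat.* m) ≤ γ) × (γ ≤ + (2 Data.Nat.* m Data.Nat.+ 1))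
proposition2 _ (s≤s (s≤s (s≤s (s≤s (s≤s {n = j} z≤n))))) γ ((f , f-sdr , f-weight) , minimal) =
  subst (+ (2 ℕ.* m) ≤_) (trans (sym (sdrWeight≡totalWeight f)) f-weight)
        (ValidColumns⇒2m≤totalWeight (columnsOf f) (IsSDRDF⇒ValidColumns f-sdr)) ,
  subst (γ ≤_) (trans (sdrWeight≡totalWeight (labelling L₀)) (trans (totalWeight-labelling L₀) L₀-weight))
        (minimal (labelling L₀) (ValidColumns⇒IsSDRDF L₀ L₀-valid))
  where
  open Columns (4 ℕ.+ j)
  open FlowerSnark (4 ℕ.+ j) (s≤s (s≤s z≤n))
  open Construction j
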